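{- Let $\mu_1,\dots,\mu_n$ be a trace for a discreet clean process $P_0$ and stack $\sigma_0$, with corresponding stacks $\sigma_0,\dots,\sigma_n$. Suppose $\sigma_0=\sigma_n$ and $|\sigma_i|>|\sigma_0|$ for all $0<i<n$. Then $\mu_1\curvearrowright\mu_n$.
   Context: Asynchronous $\pi$-calculus: processes $P ::= a\langle\tilde b\rangle \mid\ !a(\tilde b).P \mid P|Q \mid (\nu a)P \mid G$, $G ::= \mathbf 0 \mid a(\tilde b).P \mid \tau.P \mid [a=b]G \mid G+G'$, well-sorted; $\xrightarrow{\mu}$ is the standard early LTS of the asynchronous $\pi$-calculus (actions $\tau$, $a(\tilde b)$, $(\nu\tilde c)a\langle\tilde b\rangle$). Names: output-controlled ($x,y,z$), input-controlled ($u,v,w$), continuation ($p,q,r$); $a,b,c$ range over output- and input-controlled names. Outputs at output-controlled names carry tuples $\tilde a,p$ ending with exactly one continuation name; continuation names are transmitted only this way. Sequential typing (continuation names count as output-controlled): $\vdash_1 u(\tilde a).P$ if $\vdash_1P$; $\vdash_0 x(\tilde a).P$, $\vdash_0 !x(\tilde a).P$ if $\vdash_1P$; $\vdash_1x\langle\tilde a\rangle$; $\vdash_0u\langle\tilde a\rangle$; $\vdash_\eta(\nu a)P$ if $\vdash_\eta P$; $\vdash_0\mathbf0$; $\vdash_{\eta_1+\eta_2}P|Q$ if $\vdash_{\eta_1}P,\vdash_{\eta_2}Q$, $\eta_1+\eta_2\le1$; $\vdash_\eta G_1+G_2$ if $\vdash_\eta G_1,G_2$; $\vdash_\eta\tau.P$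 if $\vdash_\eta P$; $\vdash_0[a=b]G$ if $\vdash_0G$. Type-allowed $\eta\vdash P\xrightarrow{\mu}P'$: $\vdash_\eta P$, $P\xrightarrow{\mu}P'$, and $\eta=0$ or $\mu=\tau$ or ($\eta=1$ and $\mu$ an input at an input-controlled name or an output at an output-controlled name). Stacks: sequences of $p^{\mathrm O}$/$p^{\mathrm I}$ with alternating tags, ending with an output tag unless empty, each name at most once per tag, and if a name has both tags the input occurrence immediately follows the output one; clean if no name has both tags; $\mathrm{seq}(\sigma)=1$ if $\sigma$ starts with an output tag, else $0$; $|\sigma|$ is the length. Interleaving and typing $\vdash_\sigma P$: $\sigma_1\in\sigma_2\between\sigma_3$ iff $\sigma_1$ is a stack derivable by $\emptyset\in\emptyset\between\emptyset$, $t,\sigma_1\in\sigma_2\between t,\sigma_3$, $t,\sigma_1\in t,\sigma_2\between\sigma_3$ from $\sigma_1\in\sigma_2\between\sigma_3$; $\vdash_{p^{\mathrm O}}p\langle\tilde a\rangle$; $\vdash_{p^{\mathrm O}}x\langle\tilde a,p\rangle$; $\vdash_\emptyset u\langle\tilde a\rangle$; $\vdash_{q^{\mathrm I},p^{\mathrm O}}q(\tilde a).P$ if $\vdash_{p^{\mathrm O}}P$, $p\ne q$; $\vdash_\emptyset x(\tilde a,p).P$, $\vdash_\emptyset !x(\tilde a,p).P$ if $\vdash_{p^{\mathrm O}}P$; $\vdash_{p^{\mathrm O}}u(\tilde a).P$ if $\vdash_{p^{\mathrm O}}P$; $\vdash_\emptyset\mathbf0$; $\vdash_{\xi,\sigma'}(\nu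 p)P$ if $\vdash_{\xi,p^{\mathrm O},p^{\mathrm I},\sigma'}P$ with $\xi$ empty or ending with an input tag; $\vdash_\sigma(\nu p)P$ if $\vdash_\sigma P$, $p\notin\sigma$; $\vdash_\sigma(\nu a)P$ if $\vdash_\sigma P$; $\vdash_\emptyset[a=b]P$ if $\vdash_\emptyset P$; $\vdash_{\sigma''}P|Q$ if $\vdash_\sigma P,\vdash_{\sigma'}Q$, $\sigma''\in\sigma\between\sigma'$; $\vdash_\sigma\tau.P$, $\vdash_\sigma P+Q$ from $\vdash_\sigma P$ (and $\vdash_\sigma Q$) when $|\sigma|\le1$. $P$ is clean if $\vdash_\sigma P$ for a clean $\sigma$. Typed transition $\sigma\vdash P\xrightarrow{\mu}P'$: $\vdash_\sigma P$; $\mathrm{seq}(\sigma)\vdash P\xrightarrow{\mu}P'$; if a continuation name $p\in\mathrm{fn}(\mu)$ occurs in $\sigma$ then $\sigma=p^{\mathrm O},\sigma'$ or $p^{\mathrm I},\sigma'$, and if $p$ occurs in $\sigma'$ it is not the subject of $\mu$. $\langle\sigma;P\rangle\xrightarrow{\mu}\langle\sigma';P'\rangle$ holds when $\sigma\vdash P\xrightarrow{\mu}P'$ and: if $\mu=(\nu\tilde b)p\langle\tilde a\rangle$ then $\sigma=p^{\mathrm O},\sigma'$; if $\mu=p(\tilde a)$ then $\sigma=p^{\mathrm I},\sigma'$; if $\mu=(\nu\tilde c,p)a\langle\tilde b,p\rangle$ then $\sigma'=p^{\mathrm I},\sigma$; if $\mu=(\nu\tilde c)a\langle\tilde b,p\rangle$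 ($p$ free) then $\sigma=p^{\mathrm O},\sigma'$; if $\mu=a(\tilde b,p)$ then $\sigma'=p^{\mathrm O},\sigma$; if $\mu=\tau$ then $\sigma'=\sigma''$ when $\sigma=p^{\mathrm O},p^{\mathrm I},\sigma''$ and $p\notin\mathrm{fn}(P')$, else $\sigma'=\sigma$. A typed transition is discreet if no continuation name in the object of $\mu$ is free in $\sigma$. $P$ is discreet if no free continuation name of $P$ appears in the object of an output, and for every subprocess $x(\tilde a,q).Q$, $q$ does not appear in the object of an output in $Q$. Trace: $\mu_1,\dots,\mu_n$ is a trace for a discreet clean $P_0$ and stack $\sigma_0$ if there are $\sigma_1,\dots,\sigma_n$, $P_1,\dots,P_n$ with discreet transitions $\langle\sigma_j;P_j\rangle\xrightarrow{\mu_{j+1}}\langle\sigma_{j+1};P_{j+1}\rangle$ for $0\le j<n$, where every continuation name in the object of $\mu_{j+1}$ appears in no $\mu_i$ with $i\le j$. $\mu_i\curvearrowright\mu_j$ if $i<j$ and either $\mu_i=(\nu\tilde c,p)a\langle\tilde b,p\rangle$ and $\mu_j=p(\tilde a')$, or $\mu_i=a(\tilde b,p)$ and $\mu_j=(\nu\tilde c)p\langle\tilde a'\rangle$. -}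

module Defs where

open import Data.Nat using (ℕ; zero; suc; _≤_; _<_)
open import Data.Nat.Properties using () renaming (_≟_ to _≟ℕ_)
open import Data.Bool using (Bool; true; false; if_then_else_; not; _∧_; _∨_)
open import Data.List using (List; []; _∷_; _++_; [_]; map; length; filterᵇ; foldr)
open import Data.List.Membership.Propositional using (_∈_; _∉_)
open import Data.List.Relation.Unary.All using (All)
open import Data.List.Relation.Unary.Unique.Propositional using (Unique)
open import Data.Product using (Σ; ∃; ∃₂; _×_; _,_; proj₁; proj₂)
open import Data.Sum using (_⊎_; inj₁; inj₂)
open import Data.Unit using (⊤)
open import Data.Empty using (⊥)
open import Data.Maybe using (Maybe; just; nothing)
open import Relation.Nullary using (¬_; Dec; yes; no; does)
open import Relation.Binary.PropositionalEquality using (_≡_; _≢_; refl; cong)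

-- Names.  Every name carries its kind:
--   oK = output-controlled (x,y,z), iK = input-controlled (u,v,w),
--   cK = continuation name (p,q,r).

data Kind : Set where
  oK iK cK : Kind

record Name : Set where
  constructor mkName
  field
    kind : Kind
    idx  : ℕ
open Name public

_==K_ : Kind → Kind → Bool
oK ==K oK = true
iK ==K iK = true
cK ==K cK = true
_  ==K _  = false

_==_ : Name → Name → Bool
mkName k i == mkName k' i' = (k ==K k') ∧ does (i ≟ℕ i')

elem : Name → List Name → Bool
elem n []       = false
elem n (m ∷ ms) = (n == m) ∨ elem n ms

removeAll : List Name → List Name → List Name
removeAll bs xs = filterᵇ (λ x → not (elem x bs)) xs

IsCont : Name → Set
IsCont n = kind n ≡ cK

EndsWith : List Name → Name → Set
EndsWith xs p = ∃ λ ys → xs ≡ ys ++ [ p ]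

EndsCont : List Name → Set
EndsCont xs = ∃ λ p → EndsWith xs p × IsCont p

Disjoint : List Name → List Name → Set
Disjoint xs ys = ∀ {n} → n ∈ xs → n ∈ ys → ⊥

data Proc : Set
data Guard : Set

data Proc where
  out : Name → List Name → Proc
  rep : Name → List Name → Proc → Proc
  par : Proc → Proc → Proc
  new : Name → Proc → Proc
  grd : Guard → Proc

data Guard where
  nil : Guard
  inp : Name → List Name → Proc → Guard
  tau : Proc → Guard
  mat : Name → Name → Guard → Guard
  sum : Guard → Guard → Guard

news : List Name → Proc → Proc
news cs P = foldr new P cs

fnP : Proc → List Name
fnG : Guard → List Name
fnP (out a bs)   = a ∷ bs
fnP (rep a bs P) = a ∷ removeAll bs (fnP P)
fnP (par P Q)    = fnP P ++ fnP Q
fnP (new a P)    = removeAll [ a ] (fnP P)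
fnP (grd G)      = fnG G
fnG nil          = []
fnG (inp a bs P) = a ∷ removeAll bs (fnP P)
fnG (tau P)      = fnP P
fnG (mat a b G)  = a ∷ b ∷ fnG G
fnG (sum G G')   = fnG G ++ fnG G'

bnP : Proc → List Name
bnG : Guard → List Name
bnP (out a bs)   = []
bnP (rep a bs P) = bs ++ bnP P
bnP (par P Q)    = bnP P ++ bnP Q
bnP (new a P)    = a ∷ bnP P
bnP (grd G)      = bnG G
bnG nil          = []
bnG (inp a bs P) = bs ++ bnP P
bnG (tau P)      = bnP P
bnG (mat a b G)  = bnG G
bnG (sum G G')   = bnG G ++ bnG G'

-- substitution acting on free names; bound names are left untouched
-- (capture is excluded by side conditions where it is used)
except : List Name → (Name → Name) → Name → Name
except bs f n = if elem n bs then n else f n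

substP : (Name → Name) → Proc → Proc
substG : (Name → Name) → Guard → Guard
substP f (out a bs)   = out (f a) (map f bs)
substP f (rep a bs P) = rep (f a) bs (substP (except bs f) P)
substP f (par P Q)    = par (substP f P) (substP f Q)
substP f (new a P)    = new a (substP (except [ a ] f) P)
substP f (grd G)      = grd (substG f G)
substG f nil          = nil
substG f (inp a bs P) = inp (f a) bs (substP (except bs f) P)
substG f (tau P)      = tau (substP f P)
substG f (mat a b G)  = mat (f a) (f b) (substG f G)
substG f (sum G G')   = sum (substG f G) (substG f G')

mkSub : List Name → List Name → Name → Name
mkSub []       _        n = n
mkSub (b ∷ bs) []       n = n
mkSub (b ∷ bs) (c ∷ cs) n = if n == b then c else mkSub bs cs n

renP : (Name → Name) → Proc → Proc
renG : (Name → Name) → Guard → Guard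
renP f (out a bs)   = out (f a) (map f bs)
renP f (rep a bs P) = rep (f a) (map f bs) (renP f P)
renP f (par P Q)    = par (renP f P) (renP f Q)
renP f (new a P)    = new (f a) (renP f P)
renP f (grd G)      = grd (renG f G)
renG f nil          = nil
renG f (inp a bs P) = inp (f a) (map f bs) (renP f P)
renG f (tau P)      = tau (renP f P)
renG f (mat a b G)  = mat (f a) (f b) (renG f G)
renG f (sum G G')   = sum (renG f G) (renG f G')

swapN : Name → Name → Name → Name
swapN a b n = if n == a then b else (if n == b then a else n)

swapP : Name → Name → Proc → Proc
swapP a b = renP (swapN a b)

swapG : Name → Name → Guard → Guard
swapG a b = renG (swapN a b)

-- Actions:  τ,  a(b̃)  (early input),  (ν c̃) a⟨b̃⟩  (output, c̃ extruded)

data Act : Set where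
  τ    : Act
  inA  : Name → List Name → Act
  outA : List Name → Name → List Name → Act

objA : Act → List Name
objA τ             = []
objA (inA a bs)    = bs
objA (outA cs a bs) = bs

bnA : Act → List Name
bnA (outA cs a bs) = cs
bnA _              = []

fnA : Act → List Name
fnA τ              = []
fnA (inA a bs)     = a ∷ bs
fnA (outA cs a bs) = a ∷ removeAll cs bs

namesA : Act → List Name
namesA τ              = []
namesA (inA a bs)     = a ∷ bs
namesA (outA cs a bs) = a ∷ bs ++ cs

IsSubj : Name → Act → Set
IsSubj p τ              = ⊥
IsSubj p (inA a bs)     = p ≡ a
IsSubj p (outA cs a bs) = p ≡ a

-- Sequential typing ⊢_η P  (continuation names count as output-controlled)

data ⊢seq_∶_ : ℕ → Proc → Set
data ⊢seqG_∶_ : ℕ → Guard → Set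

data ⊢seq_∶_ where
  s-rep  : ∀ {x as P} → kind x ≢ iK → ⊢seq 1 ∶ P → ⊢seq 0 ∶ rep x as P
  s-outX : ∀ {x as} → kind x ≢ iK → ⊢seq 1 ∶ out x as
  s-outU : ∀ {u as} → kind u ≡ iK → ⊢seq 0 ∶ out u as
  s-new  : ∀ {η a P} → ⊢seq η ∶ P → ⊢seq η ∶ new a P
  s-par  : ∀ {η₁ η₂ P Q} → ⊢seq η₁ ∶ P → ⊢seq η₂ ∶ Q → η₁ Data.Nat.+ η₂ ≤ 1 →
           ⊢seq (η₁ Data.Nat.+ η₂) ∶ par P Q
  s-grd  : ∀ {η G} → ⊢seqG η ∶ G → ⊢seq η ∶ grd G

data ⊢seqG_∶_ where
  s-inU : ∀ {u as P} → kind u ≡ iK → ⊢seq 1 ∶ P → ⊢seqG 1 ∶ inp u as P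
  s-inX : ∀ {x as P} → kind x ≢ iK → ⊢seq 1 ∶ P → ⊢seqG 0 ∶ inp x as P
  s-nil : ⊢seqG 0 ∶ nil
  s-sum : ∀ {η G G'} → ⊢seqG η ∶ G → ⊢seqG η ∶ G' → ⊢seqG η ∶ sum G G'
  s-tau : ∀ {η P} → ⊢seq η ∶ P → ⊢seqG η ∶ tau P
  s-mat : ∀ {a b G} → ⊢seqG 0 ∶ G → ⊢seqG 0 ∶ mat a b G

InAtIC : Act → Set
InAtIC (inA a bs) = kind a ≡ iK
InAtIC _          = ⊥

OutAtOC : Act → Set
OutAtOC (outA cs a bs) = kind a ≢ iK
OutAtOC _              = ⊥

data Tag : Set where
  O I : Tag

Entry : Set
Entry = Name × Tag

Stack : Set
Stack = List Entry

namesS : Stack → List Name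
namesS = map proj₁

data Alternating : Stack → Set where
  alt-[]  : Alternating []
  alt-[_] : ∀ e → Alternating [ e ]
  alt-∷   : ∀ {e e' σ} → proj₂ e ≢ proj₂ e' → Alternating (e' ∷ σ) → Alternating (e ∷ e' ∷ σ)

EndsWithOutTag : Stack → Set
EndsWithOutTag σ = σ ≡ [] ⊎ ∃₂ λ σ' p → σ ≡ σ' ++ [ (p , O) ]

EndsWithInTag : Stack → Set
EndsWithInTag σ = ∃₂ λ σ' p → σ ≡ σ' ++ [ (p , I) ]

record IsStack (σ : Stack) : Set where
  field
    conts       : All (λ e → IsCont (proj₁ e)) σ
    alternating : Alternating σ
    endsOut     : EndsWithOutTag σ
    oncePerTag  : Unique σ
    adjacent    : ∀ p → (p , O) ∈ σ → (p , I) ∈ σ →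
                  ∃₂ λ σ₁ σ₂ → σ ≡ σ₁ ++ (p , O) ∷ (p , I) ∷ σ₂

CleanS : Stack → Set
CleanS σ = ∀ p → (p , O) ∈ σ → (p , I) ∈ σ → ⊥

seqS : Stack → ℕ
seqS ((_ , O) ∷ _) = 1
seqS _             = 0

data Shuffle : Stack → Stack → Stack → Set where
  sh-nil : Shuffle [] [] []
  sh-r   : ∀ {t σ₁ σ₂ σ₃} → Shuffle σ₁ σ₂ σ₃ → Shuffle (t ∷ σ₁) σ₂ (t ∷ σ₃)
  sh-l   : ∀ {t σ₁ σ₂ σ₃} → Shuffle σ₁ σ₂ σ₃ → Shuffle (t ∷ σ₁) (t ∷ σ₂) σ₃

_∈_⋈_ : Stack → Stack → Stack → Set
σ₁ ∈ σ₂ ⋈ σ₃ = IsStack σ₁ × Shuffle σ₁ σ₂ σ₃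

data ⊢_∶_ : Stack → Proc → Set
data ⊢G_∶_ : Stack → Guard → Set

data ⊢_∶_ where
  t-outP    : ∀ {p as} → IsCont p → ⊢ [ (p , O) ] ∶ out p as
  t-outX    : ∀ {x as p} → kind x ≡ oK → IsCont p → ⊢ [ (p , O) ] ∶ out x (as ++ [ p ])
  t-outU    : ∀ {u as} → kind u ≡ iK → ⊢ [] ∶ out u as
  t-repX    : ∀ {x as p P} → kind x ≡ oK → IsCont p → ⊢ [ (p , O) ] ∶ P →
              ⊢ [] ∶ rep x (as ++ [ p ]) P
  t-newC    : ∀ {ξ σ' p P} → IsCont p → (ξ ≡ [] ⊎ EndsWithInTag ξ) →
              ⊢ ξ ++ (p , O) ∷ (p , I) ∷ σ' ∶ P → ⊢ ξ ++ σ' ∶ new p P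
  t-newC'   : ∀ {σ p P} → IsCont p → p ∉ namesS σ → ⊢ σ ∶ P → ⊢ σ ∶ new p P
  t-new     : ∀ {σ a P} → ¬ IsCont a → ⊢ σ ∶ P → ⊢ σ ∶ new a P
  t-par     : ∀ {σ σ' σ'' P Q} → ⊢ σ ∶ P → ⊢ σ' ∶ Q → σ'' ∈ σ ⋈ σ' → ⊢ σ'' ∶ par P Q
  t-grd     : ∀ {σ G} → ⊢G σ ∶ G → ⊢ σ ∶ grd G

data ⊢G_∶_ where
  t-inQ  : ∀ {q p as P} → IsCont q → IsCont p → p ≢ q → ⊢ [ (p , O) ] ∶ P →
           ⊢G (q , I) ∷ (p , O) ∷ [] ∶ inp q as P
  t-inX  : ∀ {x as p P} → kind x ≡ oK → IsCont p → ⊢ [ (p , O) ] ∶ P →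
           ⊢G [] ∶ inp x (as ++ [ p ]) P
  t-inU  : ∀ {u as p P} → kind u ≡ iK → ⊢ [ (p , O) ] ∶ P → ⊢G [ (p , O) ] ∶ inp u as P
  t-nil  : ⊢G [] ∶ nil
  t-mat  : ∀ {a b G} → ⊢G [] ∶ G → ⊢G [] ∶ mat a b G
  t-tau  : ∀ {σ P} → length σ ≤ 1 → ⊢ σ ∶ P → ⊢G σ ∶ tau P
  t-sum  : ∀ {σ G G'} → length σ ≤ 1 → ⊢G σ ∶ G → ⊢G σ ∶ G' → ⊢G σ ∶ sum G G'

CleanP : Proc → Set
CleanP P = ∃ λ σ → CleanS σ × ⊢ σ ∶ P

NoOutObj : Name → Proc → Set
NoOutObjG : Name → Guard → Set
NoOutObj p (out a bs)   = p ∉ bs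
NoOutObj p (rep a bs P) = if elem p bs then ⊤ else NoOutObj p P
NoOutObj p (par P Q)    = NoOutObj p P × NoOutObj p Q
NoOutObj p (new a P)    = if p == a then ⊤ else NoOutObj p P
NoOutObj p (grd G)      = NoOutObjG p G
NoOutObjG p nil          = ⊤
NoOutObjG p (inp a bs P) = if elem p bs then ⊤ else NoOutObj p P
NoOutObjG p (tau P)      = NoOutObj p P
NoOutObjG p (mat a b G)  = NoOutObjG p G
NoOutObjG p (sum G G')   = NoOutObjG p G × NoOutObjG p G'

inputsP : Proc → List (Name × List Name × Proc)
inputsG : Guard → List (Name × List Name × Proc)
inputsP (out a bs)   = []
inputsP (rep a bs P) = (a , bs , P) ∷ inputsP P
inputsP (par P Q)    = inputsP P ++ inputsP Q
inputsP (new a P)    = inputsP P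
inputsP (grd G)      = inputsG G
inputsG nil          = []
inputsG (inp a bs P) = (a , bs , P) ∷ inputsP P
inputsG (tau P)      = inputsP P
inputsG (mat a b G)  = inputsG G
inputsG (sum G G')   = inputsG G ++ inputsG G'

record DiscreetP (P : Proc) : Set where
  field
    freeConts : ∀ p → IsCont p → p ∈ fnP P → NoOutObj p P
    inputs    : ∀ x bs q Q → (x , bs , Q) ∈ inputsP P → kind x ≡ oK → EndsWith bs q →
                NoOutObj q Q

record Sorting : Set₁ where
  field
    Sort     : Set
    sortOf   : Name → Sort
    objSorts : Sort → List Sort
    sortKind : Sort → Kind
    sortOf-kind : ∀ n → sortKind (sortOf n) ≡ kind n
    oc-shape : ∀ n → kind n ≡ oK → ∃₂ λ ss s → objSorts (sortOf n) ≡ ss ++ [ s ] ×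
               sortKind s ≡ cK × All (λ s' → sortKind s' ≢ cK) ss
    other-shape : ∀ n → kind n ≢ oK → All (λ s → sortKind s ≢ cK) (objSorts (sortOf n))
    fresh : ∀ (n : Name) (ns : List Name) → ∃ λ m → sortOf m ≡ sortOf n × m ∉ ns

module Calculus (S : Sorting) where
  open Sorting S

  WellSortedUse : Name → List Name → Set
  WellSortedUse a bs = map sortOf bs ≡ objSorts (sortOf a)

  data WellSorted : Proc → Set
  data WellSortedG : Guard → Set
  data WellSorted where
    ws-out : ∀ {a bs} → WellSortedUse a bs → WellSorted (out a bs)
    ws-rep : ∀ {a bs P} → WellSortedUse a bs → WellSorted P → WellSorted (rep a bs P)
    ws-par : ∀ {P Q} → WellSorted P → WellSorted Q → WellSorted (par P Q)
    ws-new : ∀ {a P} → WellSorted P → WellSorted (new a P)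
    ws-grd : ∀ {G} → WellSortedG G → WellSorted (grd G)
  data WellSortedG where
    ws-nil : WellSortedG nil
    ws-inp : ∀ {a bs P} → WellSortedUse a bs → WellSorted P → WellSortedG (inp a bs P)
    ws-tau : ∀ {P} → WellSorted P → WellSortedG (tau P)
    ws-mat : ∀ {a b G} → ¬ IsCont a → ¬ IsCont b → WellSortedG G → WellSortedG (mat a b G)
    ws-sum : ∀ {G G'} → WellSortedG G → WellSortedG G' → WellSortedG (sum G G')

  data _≈α_ : Proc → Proc → Set
  data _≈αG_ : Guard → Guard → Set
  data _≈α_ where
    α-refl  : ∀ {P} → P ≈α P
    α-sym   : ∀ {P Q} → P ≈α Q → Q ≈α P
    α-trans : ∀ {P Q R} → P ≈α Q → Q ≈α R → P ≈α R
    α-new   : ∀ {a b P} → sortOf a ≡ sortOf b → b ∉ fnP (new a P) →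
              new a P ≈α new b (swapP a b P)
    α-rep   : ∀ {a bs b c P} → b ∈ bs → sortOf b ≡ sortOf c → c ∉ fnP (rep a bs P) → c ∉ bs →
              rep a bs P ≈α rep a (map (swapN b c) bs) (swapP b c P)
    c-rep   : ∀ {a bs P Q} → P ≈α Q → rep a bs P ≈α rep a bs Q
    c-par   : ∀ {P P' Q Q'} → P ≈α P' → Q ≈α Q' → par P Q ≈α par P' Q'
    c-new   : ∀ {a P Q} → P ≈α Q → new a P ≈α new a Q
    c-grd   : ∀ {G G'} → G ≈αG G' → grd G ≈α grd G'
  data _≈αG_ where
    αG-refl  : ∀ {G} → G ≈αG G
    αG-sym   : ∀ {G G'} → G ≈αG G' → G' ≈αG G
    αG-trans : ∀ {G G' G''} → G ≈αG G' → G' ≈αG G'' → G ≈αG G''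
    α-inp    : ∀ {a bs b c P} → b ∈ bs → sortOf b ≡ sortOf c → c ∉ fnG (inp a bs P) → c ∉ bs →
               inp a bs P ≈αG inp a (map (swapN b c) bs) (swapP b c P)
    c-inp    : ∀ {a bs P Q} → P ≈α Q → inp a bs P ≈αG inp a bs Q
    c-tau    : ∀ {P Q} → P ≈α Q → tau P ≈αG tau Q
    c-mat    : ∀ {a b G G'} → G ≈αG G' → mat a b G ≈αG mat a b G'
    c-sum    : ∀ {G₁ G₁' G₂ G₂'} → G₁ ≈αG G₁' → G₂ ≈αG G₂' → sum G₁ G₂ ≈αG sum G₁' G₂'

  data _─[_]→_ : Proc → Act → Proc → Set
  data _─[_]→G_ : Guard → Act → Proc → Set
  data _─[_]→_ where
    l-out   : ∀ {a bs} → out a bs ─[ outA [] a bs ]→ grd nil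
    l-rep   : ∀ {a bs cs P} → length cs ≡ length bs → WellSortedUse a cs → Disjoint cs (bnP P) →
              rep a bs P ─[ inA a cs ]→ par (substP (mkSub bs cs) P) (rep a bs P)
    l-grd   : ∀ {G μ P'} → G ─[ μ ]→G P' → grd G ─[ μ ]→ P'
    l-parL  : ∀ {P P' Q μ} → P ─[ μ ]→ P' → Disjoint (bnA μ) (fnP Q) → par P Q ─[ μ ]→ par P' Q
    l-parR  : ∀ {P Q Q' μ} → Q ─[ μ ]→ Q' → Disjoint (bnA μ) (fnP P) → par P Q ─[ μ ]→ par P Q'
    l-comL  : ∀ {P P' Q Q' cs a bs} → P ─[ outA cs a bs ]→ P' → Q ─[ inA a bs ]→ Q' →
              Disjoint cs (fnP Q) → par P Q ─[ τ ]→ news cs (par P' Q')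
    l-comR  : ∀ {P P' Q Q' cs a bs} → P ─[ inA a bs ]→ P' → Q ─[ outA cs a bs ]→ Q' →
              Disjoint cs (fnP P) → par P Q ─[ τ ]→ news cs (par P' Q')
    l-res   : ∀ {a P P' μ} → P ─[ μ ]→ P' → a ∉ namesA μ → new a P ─[ μ ]→ new a P'
    l-open  : ∀ {d P P' cs a bs} → P ─[ outA cs a bs ]→ P' → d ∈ bs → d ≢ a → d ∉ cs →
              new d P ─[ outA (d ∷ cs) a bs ]→ P'
    l-alpha : ∀ {P Q Q' μ} → P ≈α Q → Q ─[ μ ]→ Q' → P ─[ μ ]→ Q'
  data _─[_]→G_ where
    l-inp   : ∀ {a bs cs P} → length cs ≡ length bs → WellSortedUse a cs → Disjoint cs (bnP P) →
              inp a bs P ─[ inA a cs ]→G substP (mkSub bs cs) P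
    l-tau   : ∀ {P} → tau P ─[ τ ]→G P
    l-sumL  : ∀ {G G' μ P'} → G ─[ μ ]→G P' → sum G G' ─[ μ ]→G P'
    l-sumR  : ∀ {G G' μ P'} → G' ─[ μ ]→G P' → sum G G' ─[ μ ]→G P'
    l-mat   : ∀ {a G μ P'} → G ─[ μ ]→G P' → mat a a G ─[ μ ]→G P'

  Allowed : ℕ → Proc → Act → Proc → Set
  Allowed η P μ P' = ⊢seq η ∶ P × (P ─[ μ ]→ P') ×
                     (η ≡ 0 ⊎ μ ≡ τ ⊎ (η ≡ 1 × (InAtIC μ ⊎ OutAtOC μ)))

  record TTrans (σ : Stack) (P : Proc) (μ : Act) (P' : Proc) : Set where
    field
      typed   : ⊢ σ ∶ P
      allowed : Allowed (seqS σ) P μ P'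
      contOK  : ∀ p → IsCont p → p ∈ fnA μ → p ∈ namesS σ →
                ∃₂ λ t σ' → σ ≡ (p , t) ∷ σ' × (p ∈ namesS σ' → ¬ IsSubj p μ)

  data ⟨_﹔_⟩─[_]→⟨_﹔_⟩ : Stack → Proc → Act → Stack → Proc → Set where
    st-outCont  : ∀ {σ σ' P P' cs p as} → IsCont p → TTrans σ P (outA cs p as) P' →
                  σ ≡ (p , O) ∷ σ' → ⟨ σ ﹔ P ⟩─[ outA cs p as ]→⟨ σ' ﹔ P' ⟩
    st-inCont   : ∀ {σ σ' P P' p as} → IsCont p → TTrans σ P (inA p as) P' →
                  σ ≡ (p , I) ∷ σ' → ⟨ σ ﹔ P ⟩─[ inA p as ]→⟨ σ' ﹔ P' ⟩
    st-outBound : ∀ {σ σ' P P' cs a bs p} → ¬ IsCont a → IsCont p → p ∈ cs →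
                  TTrans σ P (outA cs a (bs ++ [ p ])) P' →
                  σ' ≡ (p , I) ∷ σ → ⟨ σ ﹔ P ⟩─[ outA cs a (bs ++ [ p ]) ]→⟨ σ' ﹔ P' ⟩
    st-outFree  : ∀ {σ σ' P P' cs a bs p} → ¬ IsCont a → IsCont p → p ∉ cs →
                  TTrans σ P (outA cs a (bs ++ [ p ])) P' →
                  σ ≡ (p , O) ∷ σ' → ⟨ σ ﹔ P ⟩─[ outA cs a (bs ++ [ p ]) ]→⟨ σ' ﹔ P' ⟩
    st-inObj    : ∀ {σ σ' P P' a bs p} → ¬ IsCont a → IsCont p →
                  TTrans σ P (inA a (bs ++ [ p ])) P' →
                  σ' ≡ (p , O) ∷ σ → ⟨ σ ﹔ P ⟩─[ inA a (bs ++ [ p ]) ]→⟨ σ' ﹔ P' ⟩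
    st-tauPop   : ∀ {σ σ' P P' p} → TTrans σ P τ P' →
                  σ ≡ (p , O) ∷ (p , I) ∷ σ' → p ∉ fnP P' → ⟨ σ ﹔ P ⟩─[ τ ]→⟨ σ' ﹔ P' ⟩
    st-tauKeep  : ∀ {σ P P'} → TTrans σ P τ P' →
                  ¬ (∃₂ λ p σ'' → σ ≡ (p , O) ∷ (p , I) ∷ σ'' × p ∉ fnP P') →
                  ⟨ σ ﹔ P ⟩─[ τ ]→⟨ σ ﹔ P' ⟩
    st-outOther : ∀ {σ P P' cs a bs} → ¬ IsCont a → ¬ EndsCont bs →
                  TTrans σ P (outA cs a bs) P' → ⟨ σ ﹔ P ⟩─[ outA cs a bs ]→⟨ σ ﹔ P' ⟩
    st-inOther  : ∀ {σ P P' a bs} → ¬ IsCont a → ¬ EndsCont bs →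
                  TTrans σ P (inA a bs) P' → ⟨ σ ﹔ P ⟩─[ inA a bs ]→⟨ σ ﹔ P' ⟩

  DiscreetT : Stack → Act → Set
  DiscreetT σ μ = ∀ p → IsCont p → p ∈ objA μ → p ∉ namesS σ

  record Trace (P₀ : Proc) (n : ℕ) (μ : ℕ → Act) (σ : ℕ → Stack) (P : ℕ → Proc) : Set where
    field
      start    : P 0 ≡ P₀
      steps    : ∀ j → j < n → ⟨ σ j ﹔ P j ⟩─[ μ (suc j) ]→⟨ σ (suc j) ﹔ P (suc j) ⟩
      discreet : ∀ j → j < n → DiscreetT (σ j) (μ (suc j))
      freshObj : ∀ j → j < n → ∀ p → IsCont p → p ∈ objA (μ (suc j)) →
                 ∀ i → 1 ≤ i → i ≤ j → p ∉ namesA (μ i)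

Causes : ℕ → ℕ → Act → Act → Set
Causes i j μᵢ μⱼ = i < j ×
  ( (∃ λ cs → ∃ λ a → ∃ λ bs → ∃ λ p → ¬ IsCont a × IsCont p × p ∈ cs ×
       μᵢ ≡ outA cs a (bs ++ [ p ]) × ∃ λ as' → μⱼ ≡ inA p as')
  ⊎ (∃ λ a → ∃ λ bs → ∃ λ p → ¬ IsCont a × IsCont p ×
       μᵢ ≡ inA a (bs ++ [ p ]) × ∃ λ cs → ∃ λ as' → μⱼ ≡ outA cs p as'))

{-# OPTIONS --safe #-}
-- The first action pushes a continuation entry (p , t) onto σ 0, since the stack grows.
-- While the stack stays above σ 0 this entry is never removed, and since later actions
-- only push names that do not occur in μ 1, p never reappears above it.  The last step
-- returns to σ 0, so it must remove exactly this entry; discreetness excludes doing so by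
-- sending p as an object, hence μ n has subject p with the polarity matching μ 1.
module Submission where

open import Defs
open import Data.Nat using (ℕ; zero; suc; _≤_; _<_; s≤s; z≤n)
open import Data.Nat.Properties using (<-irrefl; ≤⇒≯; <⇒≯; n≤1+n; m≤n+m; n<1+n; <-trans)
open import Data.List using (List; []; _∷_; _++_; [_]; length)
open import Data.List.Properties using (length-++-≤ʳ; ∷-injectiveʳ)
open import Data.List.Membership.Propositional using (_∈_; _∉_)
open import Data.List.Membership.Propositional.Properties using (∈-++⁺ˡ; ∈-++⁺ʳ)
open import Data.List.Relation.Unary.Any using (here; there)
open import Data.Product using (∃; _×_; _,_)
open import Data.Sum using (inj₁; inj₂)
open import Data.Empty using (⊥-elim)
open import Relation.Nullary using (¬_)
open import Relation.Binary.PropositionalEquality using (_≡_; _≢_; refl; sym; cong)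

xs≢ys++x∷xs : ∀ {A : Set} (ys : List A) x xs → xs ≢ ys ++ x ∷ xs
xs≢ys++x∷xs ys x xs eq = <-irrefl (cong length eq) (length-++-≤ʳ (x ∷ xs) {ys})

Opens : Name → Tag → Act → Set
Opens p I μ = ∃ λ cs → ∃ λ a → ∃ λ bs → ¬ IsCont a × IsCont p × p ∈ cs × μ ≡ outA cs a (bs ++ [ p ])
Opens p O μ = ∃ λ a → ∃ λ bs → ¬ IsCont a × IsCont p × μ ≡ inA a (bs ++ [ p ])

Closes : Name → Tag → Act → Set
Closes p I μ = ∃ λ as → μ ≡ inA p as
Closes p O μ = ∃ λ cs → ∃ λ as → μ ≡ outA cs p as

opens-cont : ∀ {p} t {μ} → Opens p t μ → IsCont p
opens-cont I (_ , _ , _ , _ , cp , _ , _) = cp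
opens-cont O (_ , _ , _ , cp , _) = cp

opens-∈-obj : ∀ {p} t {μ} → Opens p t μ → p ∈ objA μ
opens-∈-obj I (_ , _ , bs , _ , _ , _ , refl) = ∈-++⁺ʳ bs (here refl)
opens-∈-obj O (_ , bs , _ , _ , refl) = ∈-++⁺ʳ bs (here refl)

∈-obj⇒∈-names : ∀ {p} μ → p ∈ objA μ → p ∈ namesA μ
∈-obj⇒∈-names (inA a bs) p∈ = there p∈
∈-obj⇒∈-names (outA cs a bs) p∈ = there (∈-++⁺ˡ p∈)

opens-closes⇒causes : ∀ {i j p} t {μᵢ μⱼ} → i < j → Opens p t μᵢ → Closes p t μⱼ → Causes i j μᵢ μⱼ
opens-closes⇒causes I i<j (cs , a , bs , na , cp , p∈cs , eqᵢ) cl =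
  i<j , inj₁ (cs , a , bs , _ , na , cp , p∈cs , eqᵢ , cl)
opens-closes⇒causes O i<j (a , bs , na , cp , eqᵢ) cl =
  i<j , inj₂ (a , bs , _ , na , cp , eqᵢ , cl)

data StackStep : Stack → Act → Stack → Set where
  push    : ∀ {σ p t μ} → Opens p t μ → StackStep σ μ ((p , t) ∷ σ)
  popSubj : ∀ {σ p t μ} → Closes p t μ → StackStep ((p , t) ∷ σ) μ σ
  popObj  : ∀ {σ p μ} → IsCont p → p ∈ objA μ → StackStep ((p , O) ∷ σ) μ σ
  popPair : ∀ {σ p μ} → StackStep ((p , O) ∷ (p , I) ∷ σ) μ σ
  keep    : ∀ {σ μ} → StackStep σ μ σ

growing-step⇒push : ∀ {σ σ' μ} → StackStep σ μ σ' → length σ < length σ' →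
                    ∃ λ p → ∃ λ t → Opens p t μ × σ' ≡ (p , t) ∷ σ
growing-step⇒push (push op) _ = _ , _ , op , refl
growing-step⇒push {σ' = σ'} (popSubj _) lt = ⊥-elim (≤⇒≯ (n≤1+n (length σ')) lt)
growing-step⇒push {σ' = σ'} (popObj _ _) lt = ⊥-elim (≤⇒≯ (n≤1+n (length σ')) lt)
growing-step⇒push {σ' = σ'} popPair lt = ⊥-elim (≤⇒≯ (m≤n+m (length σ') 2) lt)
growing-step⇒push keep lt = ⊥-elim (<-irrefl refl lt)

record Pending (p : Name) (t : Tag) (σ₀ σ : Stack) : Set where
  constructor pending
  field
    above   : Stack
    split   : σ ≡ above ++ (p , t) ∷ σ₀
    p∉above : p ∉ namesS above

pending-pop : ∀ {p t σ₀ e σ} → Pending p t σ₀ (e ∷ σ) → length σ₀ < length σ → Pending p t σ₀ σ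
pending-pop (pending [] refl _) lt = ⊥-elim (<-irrefl refl lt)
pending-pop (pending (_ ∷ ρ) refl p∉) _ = pending ρ refl (λ p∈ → p∉ (there p∈))

pending-step : ∀ {p t σ₀ σ σ' μ} → Pending p t σ₀ σ → StackStep σ μ σ' →
               (∀ q → IsCont q → q ∈ objA μ → q ≢ p) → length σ₀ < length σ' →
               Pending p t σ₀ σ'
pending-step (pending ρ eq p∉) (push {p = q} {t = t'} op) fresh _ =
  pending ((q , t') ∷ ρ) (cong ((q , t') ∷_) eq) λ
    { (here p≡q) → fresh q (opens-cont t' op) (opens-∈-obj t' op) (sym p≡q)
    ; (there p∈) → p∉ p∈ }
pending-step pd (popSubj _) _ lt = pending-pop pd lt
pending-step pd (popObj _ _) _ lt = pending-pop pd lt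
pending-step pd popPair _ lt = pending-pop (pending-pop pd (<-trans lt (n<1+n _))) lt
pending-step pd keep _ _ = pd

pending-longer : ∀ {p t σ₀ σ} → Pending p t σ₀ σ → length σ₀ < length σ
pending-longer {p = p} {t} {σ₀} (pending ρ refl _) = length-++-≤ʳ ((p , t) ∷ σ₀) {ρ}

-- p ∉ above is what excludes a τ-step popping (p , O) ∷ (p , I) straight down to σ₀.
pending-return : ∀ {p t σ₀ σ μ σ'} → Pending p t σ₀ σ → StackStep σ μ σ' → σ' ≡ σ₀ →
                 (∀ q → IsCont q → q ∈ objA μ → q ∉ namesS σ) → Closes p t μ
pending-return pd (push _) refl _ = ⊥-elim (<⇒≯ (pending-longer pd) (n<1+n _))
pending-return pd keep refl _ = ⊥-elim (<-irrefl refl (pending-longer pd))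
pending-return (pending [] refl _) (popSubj cl) refl _ = cl
pending-return (pending (_ ∷ ρ) eq _) (popSubj _) refl _ = ⊥-elim (xs≢ys++x∷xs ρ _ _ (∷-injectiveʳ eq))
pending-return pd (popObj cq q∈obj) refl discreet = ⊥-elim (discreet _ cq q∈obj (here refl))
pending-return (pending [] eq _) popPair refl _ = ⊥-elim (xs≢ys++x∷xs [] _ _ (sym (∷-injectiveʳ eq)))
pending-return (pending (_ ∷ []) refl p∉) popPair refl _ = ⊥-elim (p∉ (here refl))
pending-return (pending (_ ∷ _ ∷ ρ) eq _) popPair refl _ =
  ⊥-elim (xs≢ys++x∷xs ρ _ _ (∷-injectiveʳ (∷-injectiveʳ eq)))

module _ (S : Sorting) where
  open Calculus S

  stackStep : ∀ {σ P μ σ' P'} → ⟨ σ ﹔ P ⟩─[ μ ]→⟨ σ' ﹔ P' ⟩ → StackStep σ μ σ'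
  stackStep (st-outCont _ _ refl) = popSubj (_ , _ , refl)
  stackStep (st-inCont _ _ refl) = popSubj (_ , refl)
  stackStep (st-outBound na cp p∈cs _ refl) = push (_ , _ , _ , na , cp , p∈cs , refl)
  stackStep (st-outFree {bs = bs} _ cp _ _ refl) = popObj cp (∈-++⁺ʳ bs (here refl))
  stackStep (st-inObj na cp _ refl) = push (_ , _ , na , cp , refl)
  stackStep (st-tauPop _ refl _) = popPair
  stackStep (st-tauKeep _ _) = keep
  stackStep (st-outOther _ _ _) = keep
  stackStep (st-inOther _ _ _) = keep

  module _ {P₀ n μ σ P} (tr : Trace P₀ n μ σ P)
           (higher : ∀ i → 0 < i → i < n → length (σ 0) < length (σ i))
           {p t} (opens : Opens p t (μ 1)) (σ₁≡ : σ 1 ≡ (p , t) ∷ σ 0) where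
    open Trace tr

    pending-trace : ∀ i → 1 ≤ i → i < n → Pending p t (σ 0) (σ i)
    pending-trace (suc zero) _ _ = pending [] σ₁≡ λ ()
    pending-trace (suc (suc i)) _ i+2<n =
      pending-step (pending-trace (suc i) (s≤s z≤n) i+1<n) (stackStep (steps (suc i) i+1<n))
                   fresh (higher (suc (suc i)) (s≤s z≤n) i+2<n)
      where
        i+1<n = <-trans (n<1+n _) i+2<n
        fresh : ∀ q → IsCont q → q ∈ objA (μ (suc (suc i))) → q ≢ p
        fresh q cq q∈obj refl = freshObj (suc i) i+1<n q cq q∈obj 1 (s≤s z≤n) (s≤s z≤n)
                                  (∈-obj⇒∈-names (μ 1) (opens-∈-obj t opens))

    last-closes : ∀ k → suc k ≡ n → 1 ≤ k → σ 0 ≡ σ n → Closes p t (μ n)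
    last-closes k refl 1≤k σ₀≡σₙ =
      pending-return (pending-trace k 1≤k (n<1+n k))
                     (stackStep (steps k (n<1+n k))) (sym σ₀≡σₙ)
                     (discreet k (n<1+n k))

mainTheorem14 : (S : Sorting) → let open Calculus S in
    ∀ (P₀ : Proc) (n : ℕ) (μ : ℕ → Act) (σ : ℕ → Stack) (P : ℕ → Proc) →
    WellSorted P₀ → DiscreetP P₀ → CleanP P₀ →
    Trace P₀ n μ σ P →
    2 ≤ n →
    σ 0 ≡ σ n →
    (∀ i → 0 < i → i < n → length (σ 0) < length (σ i)) →
    Causes 1 n (μ 1) (μ n)
mainTheorem14 S P₀ (suc (suc k)) μ σ P _ _ _ tr (s≤s (s≤s _)) σ₀≡σₙ higher
  with growing-step⇒push (stackStep S (Calculus.Trace.steps tr 0 (s≤s z≤n)))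
                         (higher 1 (s≤s z≤n) (s≤s (s≤s z≤n)))
... | p , t , opens , σ₁≡ =
  opens-closes⇒causes t (s≤s (s≤s z≤n)) opens
    (last-closes S tr higher opens σ₁≡ (suc k) refl (s≤s z≤n) σ₀≡σₙ)
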